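{- Let $TCS$ be the total constant specification for $\mathcal{GLP}_0$. For every $p\in Var$ and all $t,s\in Jt$, \[ \not\vdash_{\mathcal{GLP}_{TCS}}\neg\neg t:p\rightarrow s:\neg\neg p. \]
   Context: Justification terms $Jt$ are generated by $t::= c\mid x\mid [t+t]\mid [t\cdot t]\mid\, !t\mid\, ?t$, where $c$ ranges over constants $C=\{c_i\mid i\in\mathbb{N}\}$ and $x$ over variables $V=\{x_i\}$. The language $\mathcal{L}_J$ is $\phi::=\bot\mid p\mid(\phi\rightarrow\phi)\mid(\phi\land\phi)\mid t:\phi$ with $p\in Var=\{p_i\mid i\in\mathbb{N}\}$; $\neg\phi:=\phi\rightarrow\bot$. The calculus $\mathcal{GLP}_0$ over $\mathcal{L}_J$ has the axiom schemes (A1) $(\phi\rightarrow\psi)\rightarrow((\psi\rightarrow\chi)\rightarrow(\phi\rightarrow\chi))$; (A2) $(\phi\land\psi)\rightarrow\phi$; (A3) $(\phi\land\psi)\rightarrow(\psi\land\phi)$; (A5a) $(\phi\rightarrow(\psi\rightarrow\chi))\rightarrow((\phi\land\psi)\rightarrow\chi)$; (A5b) $((\phi\land\psi)\rightarrow\chi)\rightarrow(\phi\rightarrow(\psi\rightarrow\chi))$; (A6) $((\phi\rightarrow\psi)\rightarrow\chi)\rightarrow(((\psi\rightarrow\phi)\rightarrow\chi)\rightarrow\chi)$; (A7) $\bot\rightarrow\phi$; (G4) $\phi\rightarrow(\phi\land\phi)$; (J) $t:(\phi\rightarrow\psi)\rightarrow(s:\phi\rightarrow[t\cdot s]:\psi)$;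 (+) $t:\phi\rightarrow[t+s]:\phi$ and $s:\phi\rightarrow[t+s]:\phi$; (F) $t:\phi\rightarrow\phi$; (!) $t:\phi\rightarrow\, !t:t:\phi$; and the rule (MP): from $\phi\rightarrow\psi$ and $\phi$ infer $\psi$. The total constant specification $TCS$ for $\mathcal{GLP}_0$ is the set of all formulas $c_{i_n}:\dots:c_{i_1}:\phi$ with $n\ge1$, $i_1,\dots,i_n\in\mathbb{N}$ and $\phi$ an axiom instance of $\mathcal{GLP}_0$. $\mathcal{GLP}_{TCS}$ is $\mathcal{GLP}_0$ plus the rule: from $c:\phi\in TCS$ infer $c:\phi$; $\vdash$ denotes provability. -}

module Defs where

open import Data.Nat using (ℕ)
open import Relation.Nullary using (¬_)

data Tm : Set where
  const : ℕ → Tm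
  var   : ℕ → Tm
  _⊕_   : Tm → Tm → Tm
  _⊙_   : Tm → Tm → Tm
  !_    : Tm → Tm
  ¿_    : Tm → Tm

data Fm : Set where
  ⊥'   : Fm
  prop : ℕ → Fm
  _⇒_  : Fm → Fm → Fm
  _∧_  : Fm → Fm → Fm
  _∶_  : Tm → Fm → Fm

infixr 6 _∶_
infixl 5 _∧_
infixr 4 _⇒_

∼_ : Fm → Fm
∼ φ = φ ⇒ ⊥'

infix 7 ∼_

data Axiom : Fm → Set where
  A1  : ∀ φ ψ χ → Axiom ((φ ⇒ ψ) ⇒ ((ψ ⇒ χ) ⇒ (φ ⇒ χ)))
  A2  : ∀ φ ψ → Axiom ((φ ∧ ψ) ⇒ φ)
  A3  : ∀ φ ψ → Axiom ((φ ∧ ψ) ⇒ (ψ ∧ φ))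
  A5a : ∀ φ ψ χ → Axiom ((φ ⇒ (ψ ⇒ χ)) ⇒ ((φ ∧ ψ) ⇒ χ))
  A5b : ∀ φ ψ χ → Axiom (((φ ∧ ψ) ⇒ χ) ⇒ (φ ⇒ (ψ ⇒ χ)))
  A6  : ∀ φ ψ χ → Axiom (((φ ⇒ ψ) ⇒ χ) ⇒ (((ψ ⇒ φ) ⇒ χ) ⇒ χ))
  A7  : ∀ φ → Axiom (⊥' ⇒ φ)
  G4  : ∀ φ → Axiom (φ ⇒ (φ ∧ φ))
  AJ  : ∀ t s φ ψ → Axiom ((t ∶ (φ ⇒ ψ)) ⇒ ((s ∶ φ) ⇒ ((t ⊙ s) ∶ ψ)))
  A+l : ∀ t s φ → Axiom ((t ∶ φ) ⇒ ((t ⊕ s) ∶ φ))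
  A+r : ∀ t s φ → Axiom ((s ∶ φ) ⇒ ((t ⊕ s) ∶ φ))
  AF  : ∀ t φ → Axiom ((t ∶ φ) ⇒ φ)
  A!  : ∀ t φ → Axiom ((t ∶ φ) ⇒ ((! t) ∶ (t ∶ φ)))

data TCS : Fm → Set where
  base : ∀ i {φ} → Axiom φ → TCS (const i ∶ φ)
  step : ∀ i {φ} → TCS φ → TCS (const i ∶ φ)

data ⊢_ : Fm → Set where
  ax  : ∀ {φ} → Axiom φ → ⊢ φ
  mp  : ∀ {φ ψ} → ⊢ (φ ⇒ ψ) → ⊢ φ → ⊢ ψ
  cs  : ∀ {φ} → TCS φ → ⊢ φ

infix 2 ⊢_

-- GLP is Gödel logic with justification axioms, so it is sound for the following model.  Take
-- two worlds valued in the three-element Gödel algebra 0 < ½ < 1, let p be 0 at the first world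
-- and ½ at the second, and let t:φ (whatever t is) be 1 at both worlds if φ is 1 at both, and
-- φ ⊓ ½ pointwise otherwise.  Every axiom and every TCS formula is 1 at both worlds and MP
-- preserves this.  At the second world t:p is ½, so ¬¬t:p is 1; but ¬¬p is 0 at the first
-- world, so s:¬¬p is only ½ at the second, and the implication takes the value ½ there.
module Submission where

open import Defs
open import Data.Bool using (Bool; true; false; T) renaming (_∧_ to _&&_)
open import Data.Bool.Properties using (T-∧)
open import Data.Nat using (ℕ; zero; suc)
open import Data.Product using (_×_; _,_; proj₁; proj₂)
open import Data.Unit using (tt)
open import Function.Bundles using (Equivalence)
open import Relation.Binary.PropositionalEquality using (_≡_; refl; sym; trans)
open import Relation.Nullary using (¬_)

open Equivalence using (to)

data G₃ : Set where
  𝟘 ½ 𝟙 : G₃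

infixr 4 _⇒ᵍ_
infixl 5 _⊓_

_⇒ᵍ_ : G₃ → G₃ → G₃
𝟘 ⇒ᵍ b = 𝟙
½ ⇒ᵍ 𝟘 = 𝟘
½ ⇒ᵍ _ = 𝟙
𝟙 ⇒ᵍ b = b

_⊓_ : G₃ → G₃ → G₃
𝟘 ⊓ b = 𝟘
½ ⊓ 𝟘 = 𝟘
½ ⊓ _ = ½
𝟙 ⊓ b = b

-- A value of the two-world model: the truth values at the first and at the second world.
G₃² : Set
G₃² = G₃ × G₃

⊤² : G₃²
⊤² = 𝟙 , 𝟙

infixr 5 _⇛_
infixl 6 _⊓²_

_⇛_ : G₃² → G₃² → G₃²
(a , b) ⇛ (c , d) = (a ⇒ᵍ c) , (b ⇒ᵍ d)

_⊓²_ : G₃² → G₃² → G₃²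
(a , b) ⊓² (c , d) = (a ⊓ c) , (b ⊓ d)

□ : G₃² → G₃²
□ (𝟙 , 𝟙) = ⊤²
□ (a , b) = (a ⊓ ½) , (b ⊓ ½)

⟦_⟧ : Fm → G₃²
⟦ ⊥' ⟧     = 𝟘 , 𝟘
⟦ prop _ ⟧ = 𝟘 , ½
⟦ φ ⇒ ψ ⟧  = ⟦ φ ⟧ ⇛ ⟦ ψ ⟧
⟦ φ ∧ ψ ⟧  = ⟦ φ ⟧ ⊓² ⟦ ψ ⟧
⟦ _ ∶ φ ⟧  = □ ⟦ φ ⟧

Op : ℕ → Set
Op zero    = G₃²
Op (suc n) = G₃² → Op n

Tautology : ∀ n → Op n → Set
Tautology zero    x = x ≡ ⊤²
Tautology (suc n) f = ∀ x → Tautology n (f x)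

all : (G₃ → Bool) → Bool
all p = p 𝟘 && p ½ && p 𝟙

all-sound : ∀ p → T (all p) → ∀ a → T (p a)
all-sound p holds 𝟘 = proj₁ (to (T-∧ {p 𝟘}) holds)
all-sound p holds ½ = proj₁ (to (T-∧ {p ½}) (proj₂ (to (T-∧ {p 𝟘}) holds)))
all-sound p holds 𝟙 = proj₂ (to (T-∧ {p ½}) (proj₂ (to (T-∧ {p 𝟘}) holds)))

all² : (G₃² → Bool) → Bool
all² p = all λ a → all λ b → p (a , b)

all²-sound : ∀ p → T (all² p) → ∀ x → T (p x)
all²-sound p holds (a , b) =
  all-sound (λ b → p (a , b)) (all-sound (λ a → all λ b → p (a , b)) holds a) b

isTop : G₃² → Bool
isTop (𝟙 , 𝟙) = true
isTop _       = false

isTop-sound : ∀ x → T (isTop x) → x ≡ ⊤²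
isTop-sound (𝟙 , 𝟙) _ = refl

isTautology : ∀ n → Op n → Bool
isTautology zero    x = isTop x
isTautology (suc n) f = all² λ x → isTautology n (f x)

isTautology-sound : ∀ n f → T (isTautology n f) → Tautology n f
isTautology-sound zero    x holds   = isTop-sound x holds
isTautology-sound (suc n) f holds x =
  isTautology-sound n (f x) (all²-sound (λ y → isTautology n (f y)) holds x)

axiom-valid : ∀ {φ} → Axiom φ → ⟦ φ ⟧ ≡ ⊤²
axiom-valid (A1 φ ψ χ)  = isTautology-sound 3 (λ x y z → (x ⇛ y) ⇛ (y ⇛ z) ⇛ (x ⇛ z)) tt ⟦ φ ⟧ ⟦ ψ ⟧ ⟦ χ ⟧
axiom-valid (A2 φ ψ)    = isTautology-sound 2 (λ x y → x ⊓² y ⇛ x) tt ⟦ φ ⟧ ⟦ ψ ⟧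
axiom-valid (A3 φ ψ)    = isTautology-sound 2 (λ x y → x ⊓² y ⇛ y ⊓² x) tt ⟦ φ ⟧ ⟦ ψ ⟧
axiom-valid (A5a φ ψ χ) = isTautology-sound 3 (λ x y z → (x ⇛ y ⇛ z) ⇛ (x ⊓² y ⇛ z)) tt ⟦ φ ⟧ ⟦ ψ ⟧ ⟦ χ ⟧
axiom-valid (A5b φ ψ χ) = isTautology-sound 3 (λ x y z → (x ⊓² y ⇛ z) ⇛ (x ⇛ y ⇛ z)) tt ⟦ φ ⟧ ⟦ ψ ⟧ ⟦ χ ⟧
axiom-valid (A6 φ ψ χ)  = isTautology-sound 3 (λ x y z → ((x ⇛ y) ⇛ z) ⇛ ((y ⇛ x) ⇛ z) ⇛ z) tt ⟦ φ ⟧ ⟦ ψ ⟧ ⟦ χ ⟧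
axiom-valid (A7 φ)      = isTautology-sound 1 (λ x → (𝟘 , 𝟘) ⇛ x) tt ⟦ φ ⟧
axiom-valid (G4 φ)      = isTautology-sound 1 (λ x → x ⇛ x ⊓² x) tt ⟦ φ ⟧
axiom-valid (AJ t s φ ψ) = isTautology-sound 2 (λ x y → □ (x ⇛ y) ⇛ □ x ⇛ □ y) tt ⟦ φ ⟧ ⟦ ψ ⟧
axiom-valid (A+l t s φ) = isTautology-sound 1 (λ x → □ x ⇛ □ x) tt ⟦ φ ⟧
axiom-valid (A+r t s φ) = isTautology-sound 1 (λ x → □ x ⇛ □ x) tt ⟦ φ ⟧
axiom-valid (AF t φ)    = isTautology-sound 1 (λ x → □ x ⇛ x) tt ⟦ φ ⟧
axiom-valid (A! t φ)    = isTautology-sound 1 (λ x → □ x ⇛ □ (□ x)) tt ⟦ φ ⟧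

□-⊤² : ∀ {x} → x ≡ ⊤² → □ x ≡ ⊤²
□-⊤² refl = refl

tcs-valid : ∀ {φ} → TCS φ → ⟦ φ ⟧ ≡ ⊤²
tcs-valid (base _ a) = □-⊤² (axiom-valid a)
tcs-valid (step _ c)  = □-⊤² (tcs-valid c)

⇛-⊤²-mp : ∀ {x y} → x ⇛ y ≡ ⊤² → x ≡ ⊤² → y ≡ ⊤²
⇛-⊤²-mp x⇛y refl = x⇛y

sound : ∀ {φ} → ⊢ φ → ⟦ φ ⟧ ≡ ⊤²
sound (ax a)   = axiom-valid a
sound (mp d e) = ⇛-⊤²-mp (sound d) (sound e)
sound (cs c)   = tcs-valid c

⟦¬¬t∶p⇒s∶¬¬p⟧ : ∀ i t s → ⟦ ∼ (∼ (t ∶ prop i)) ⇒ s ∶ ∼ (∼ prop i) ⟧ ≡ (𝟙 , ½)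
⟦¬¬t∶p⇒s∶¬¬p⟧ i t s = refl

mainTheorem10 : ∀ (i : ℕ) (t s : Tm) → ¬ (⊢ ((∼ (∼ (t ∶ prop i))) ⇒ (s ∶ (∼ (∼ prop i)))))
mainTheorem10 i t s d with trans (sym (⟦¬¬t∶p⇒s∶¬¬p⟧ i t s)) (sound d)
... | ()
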